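{- The series $\mathbf{gr}(\mathbf{ld})$ satisfies $$\mathbf{gr}(\mathbf{ld}) = \epsilon + \bar{\circ}\big(\mathbf{gr}(\mathbf{ld})\big) + \bar{\bullet}\Big(\mathbf{gr}\big(\mathrm{P}^2_{\odot}(\Delta(\mathbf{ld}))\big)\Big).$$
   Context: A duplicative tree is a planar rooted tree each of whose nodes is white or black; a duplicative forest is a finite word of duplicative trees, $\epsilon$ the empty forest, $\mathcal{D}^*$ the set of forests. For a forest $\mathfrak{g}$, $\circ(\mathfrak{g})$ (resp. $\bullet(\mathfrak{g})$) is the tree with white (resp. black) root and subtree sequence $\mathfrak{g}$; the concatenation of forests is $\mathfrak{g}\odot\mathfrak{g}' = \mathfrak{g}\mathfrak{g}'$. $\mathfrak{f}\Rightarrow_{\mathcal{D}}\mathfrak{f}'$ if $\mathfrak{f}'$ is obtained from $\mathfrak{f}$ by choosing a white node with subtree $\circ(\mathfrak{g})$ and replacing it by $\bullet(\mathfrak{g}\mathfrak{g})$; $\ll$ is its reflexive-transitive closure and $\mathcal{D}^*(\mathfrak{f}) = \{\mathfrak{f}' : \mathfrak{f}\ll\mathfrak{f}'\}$ (a finite set). Let $\mathbb{K}$ be a field of characteristic zero; a $\mathcal{D}^*$-series is a map $\mathcal{D}^*\to\mathbb{K}$ written as a formal sum $\sum_{\mathfrak{f}}c_{\mathfrak{f}}\mathfrak{f}$, and tensor series are formal sums of tensors $\mathfrak{f}_1\otimes\cdots\otimes\mathfrak{f}_k$. The following operations are extended linearly to series: $\bar{\circ}(\mathfrak{f}) = \circ(\mathfrak{f})$,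 $\bar{\bullet}(\mathfrak{f}) = \bullet(\mathfrak{f})$; $\Delta(\mathfrak{f}) = \mathfrak{f}\otimes\mathfrak{f}$; $\mathrm{P}^2_{\odot}(\mathfrak{f}_1\otimes\mathfrak{f}_2) = \mathfrak{f}_1\mathfrak{f}_2$; $\mathbf{gr}(\mathfrak{f}) = \sum_{\mathfrak{f}'\in\mathcal{D}^*(\mathfrak{f})}\mathfrak{f}'$. For $d\ge0$ the $d$-ladder is $\mathfrak{l}_0=\epsilon$, $\mathfrak{l}_d = \circ(\mathfrak{l}_{d-1})$, and $\mathbf{ld} = \sum_{d\ge0}\mathfrak{l}_d$. -}

module Defs where

open import Level using (Level; _⊔_)
open import Data.Nat using (ℕ; zero; suc)
open import Data.Product using (Σ; _×_; _,_; ∃)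
open import Data.List using (List; []; _∷_; _++_; map; foldr)
open import Data.List.Relation.Unary.Unique.Propositional using (Unique)
open import Data.List.Membership.Propositional using (_∈_)
open import Relation.Binary.PropositionalEquality using (_≡_; refl; cong; cong₂)
open import Relation.Binary.Construct.Closure.ReflexiveTransitive using (Star)
open import Relation.Nullary using (¬_; Dec; yes; no)
open import Function.Bundles using (_⇔_)
open import Algebra.Bundles using (CommutativeRing)

data Colour : Set where
  white black : Colour

data Tree : Set where
  node : Colour → List Tree → Tree

Forest : Set
Forest = List Tree

-- ε is the empty forest [] ; concatenation ⊙ is _++_

∘ : Forest → Tree
∘ g = node white g

• : Forest → Tree
• g = node black g

mutual
  data _⇒T_ : Tree → Tree → Set where
    root   : ∀ {g} → node white g ⇒T node black (g ++ g)
    inside : ∀ {c g g'} → g ⇒D g' → node c g ⇒T node c g'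

  data _⇒D_ : Forest → Forest → Set where
    here  : ∀ {t t' f} → t ⇒T t' → (t ∷ f) ⇒D (t' ∷ f)
    there : ∀ {t f f'} → f ⇒D f' → (t ∷ f) ⇒D (t ∷ f')

_≪_ : Forest → Forest → Set
_≪_ = Star _⇒D_

mutual
  _≟T_ : (s t : Tree) → Dec (s ≡ t)
  node white f ≟T node white g with f ≟F g
  ... | yes refl = yes refl
  ... | no ne = no λ { refl → ne refl }
  node black f ≟T node black g with f ≟F g
  ... | yes refl = yes refl
  ... | no ne = no λ { refl → ne refl }
  node white f ≟T node black g = no λ ()
  node black f ≟T node white g = no λ ()

  _≟F_ : (f g : Forest) → Dec (f ≡ g)
  [] ≟F [] = yes refl
  [] ≟F (_ ∷ _) = no λ ()
  (_ ∷ _) ≟F [] = no λ ()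
  (s ∷ f) ≟F (t ∷ g) with s ≟T t | f ≟F g
  ... | yes refl | yes refl = yes refl
  ... | no ne | _ = no λ { refl → ne refl }
  ... | _ | no ne = no λ { refl → ne refl }

splits : Forest → List (Forest × Forest)
splits [] = ([] , []) ∷ []
splits (t ∷ f) = ([] , t ∷ f) ∷ map (λ { (a , b) → (t ∷ a , b) }) (splits f)

record Field (c ℓ : Level) : Set (Level.suc (c ⊔ ℓ)) where
  field
    commutativeRing : CommutativeRing c ℓ
  open CommutativeRing commutativeRing public
  field
    0≉1     : ¬ (0# ≈ 1#)
    inverse : ∀ x → ¬ (x ≈ 0#) → Σ Carrier λ y → (x * y) ≈ 1#

module _ {c ℓ : Level} (K : Field c ℓ) where
  open Field K

  fromℕ : ℕ → Carrier
  fromℕ zero = 0#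
  fromℕ (suc n) = 1# + fromℕ n

  CharacteristicZero : Set ℓ
  CharacteristicZero = ∀ n → ¬ (fromℕ (suc n) ≈ 0#)

module Series {c ℓ : Level} (K : Field c ℓ) where
  open Field K

  -- D*-series and 2-tensor series
  Ser : Set c
  Ser = Forest → Carrier

  Ser² : Set c
  Ser² = Forest → Forest → Carrier

  sumL : List Carrier → Carrier
  sumL = foldr _+_ 0#

  _≋_ : Ser → Ser → Set ℓ
  S ≋ T = ∀ g → S g ≈ T g

  _⊕_ : Ser → Ser → Ser
  (S ⊕ T) g = S g + T g

  εS : Ser
  εS [] = 1#
  εS (_ ∷ _) = 0#

  ∘̄ : Ser → Ser
  ∘̄ S (node white h ∷ []) = S h
  ∘̄ S _ = 0#

  •̄ : Ser → Ser
  •̄ S (node black h ∷ []) = S h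
  •̄ S _ = 0#

  -- Δ(f) = f ⊗ f, extended linearly
  Δ : Ser → Ser²
  Δ S g₁ g₂ with g₁ ≟F g₂
  ... | yes _ = S g₁
  ... | no _ = 0#

  -- P²_⊙(f₁ ⊗ f₂) = f₁ f₂, extended linearly
  P²⊙ : Ser² → Ser
  P²⊙ T g = sumL (map (λ { (a , b) → T a b }) (splits g))

  -- gr extended linearly: the coefficient of g in gr(S) is the sum of S f
  -- over the (finite) set of forests f with f ≪ g.
  IsGr : Ser → Ser → Set ℓ
  IsGr S T = ∀ g → Σ (List Forest) λ L →
               Unique L × (∀ f → (f ∈ L) ⇔ (f ≪ g)) × (T g ≈ sumL (map S L))

  ladder : ℕ → Forest
  ladder zero = []
  ladder (suc d) = ∘ (ladder d) ∷ []

  -- coefficient of g in ld (ladders are pairwise distinct, so 0 or 1)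
  ld : Ser
  ld [] = 1#
  ld (node white h ∷ []) = ld h
  ld _ = 0#

module Submission where

-- The coefficient of g in gr(S) is the sum of S over the finitely many ancestors f ≪ g,
-- enumerated by running the rewriting backwards. Now ld and P²⊙(Δ ld) are the 0/1
-- indicators of the ladders and of the doubled ladders l l. Rewriting preserves depth,
-- and (doubled) ladders are determined by their depth, so every forest has at most one
-- such ancestor: gr turns both series into the indicators of "some (doubled) ladder
-- rewrites to g". The equation then says that a ladder rewrites to ∘(h) iff a ladder
-- rewrites to h, to •(h) iff a doubled ladder rewrites to h, to ε only as ε itself, and
-- never to a forest of two or more trees.

open import Defs
open import Level using (Level)
open import Data.Nat.Base as ℕ using (ℕ; zero; suc; _<_; _⊔_; s≤s)
import Data.Nat.Properties as ℕ
open import Data.Product using (Σ; ∃; _×_; _,_; proj₁; proj₂)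
open import Data.Empty using (⊥-elim)
open import Data.Sum using (_⊎_; inj₁; inj₂)
open import Data.List using (List; []; _∷_; _++_; map; length; filter; concatMap; deduplicate)
open import Data.List.Relation.Unary.Any using (here; there)
import Data.List.Relation.Unary.All as All
import Data.List.Relation.Unary.All.Properties as All
open import Data.List.Relation.Unary.AllPairs using ([]; _∷_)
open import Data.List.Relation.Unary.Unique.Propositional using (Unique)
import Data.List.Relation.Unary.Unique.Propositional.Properties as Unique
open import Data.List.Relation.Unary.Unique.DecPropositional.Properties _≟F_ using (deduplicate-!)
open import Data.List.Membership.Propositional using (_∈_; find; lose)
open import Data.List.Membership.Propositional.Properties
  using (∈-map⁺; ∈-map⁻; ∈-++⁺ˡ; ∈-++⁺ʳ; ∈-++⁻; ∈-concatMap⁺; ∈-concatMap⁻;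
         ∈-map∘filter⁺; ∈-map∘filter⁻; ∈-deduplicate⁺; ∈-deduplicate⁻)
open import Relation.Binary.PropositionalEquality as ≡ using (_≡_; refl; cong)
open import Relation.Binary.Construct.Closure.ReflexiveTransitive
  using (Star; ε; _◅_; _◅◅_; gmap; reverse)
open import Relation.Nullary using (¬_; yes; no)
open import Function using (id; flip)
open import Function.Bundles using (_⇔_; mk⇔; Equivalence)

≪-invariant : ∀ {A : Set} (φ : Forest → A) →
  (∀ {f g} → f ⇒D g → φ f ≡ φ g) → ∀ {f g} → f ≪ g → φ f ≡ φ g
≪-invariant φ inv ε       = refl
≪-invariant φ inv (s ◅ r) = ≡.trans (inv s) (≪-invariant φ inv r)

⇒D-length : ∀ {f g} → f ⇒D g → length f ≡ length g
⇒D-length (here _)  = refl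
⇒D-length (there s) = cong suc (⇒D-length s)

≪-length : ∀ {f g} → f ≪ g → length f ≡ length g
≪-length = ≪-invariant length ⇒D-length

mutual
  depthᵀ : Tree → ℕ
  depthᵀ (node _ f) = suc (depth f)

  depth : Forest → ℕ
  depth []      = 0
  depth (t ∷ f) = depthᵀ t ⊔ depth f

depth-++ : ∀ a b → depth (a ++ b) ≡ depth a ⊔ depth b
depth-++ []      b = refl
depth-++ (t ∷ a) b =
  ≡.trans (cong (depthᵀ t ⊔_) (depth-++ a b)) (≡.sym (ℕ.⊔-assoc (depthᵀ t) (depth a) (depth b)))

depth-double : ∀ a → depth (a ++ a) ≡ depth a
depth-double a = ≡.trans (depth-++ a a) (ℕ.⊔-idem (depth a))

mutual
  ⇒T-depth : ∀ {s t} → s ⇒T t → depthᵀ s ≡ depthᵀ t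
  ⇒T-depth (root {g})  = cong suc (≡.sym (depth-double g))
  ⇒T-depth (inside s) = cong suc (⇒D-depth s)

  ⇒D-depth : ∀ {f g} → f ⇒D g → depth f ≡ depth g
  ⇒D-depth (here {f = f} s)  = cong (_⊔ depth f) (⇒T-depth s)
  ⇒D-depth (there {t = t} s) = cong (depthᵀ t ⊔_) (⇒D-depth s)

≪-depth : ∀ {f g} → f ≪ g → depth f ≡ depth g
≪-depth = ≪-invariant depth ⇒D-depth

-- Black nodes weigh 2, so that ∘(g) ⇒ •(g g) increases the weight even for g = ε.
mutual
  weightᵀ : Tree → ℕ
  weightᵀ (node white f) = suc (weight f)
  weightᵀ (node black f) = suc (suc (weight f))

  weight : Forest → ℕ
  weight []      = 0
  weight (t ∷ f) = weightᵀ t ℕ.+ weight f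

weight-++ : ∀ a b → weight (a ++ b) ≡ weight a ℕ.+ weight b
weight-++ []      b = refl
weight-++ (t ∷ a) b =
  ≡.trans (cong (weightᵀ t ℕ.+_) (weight-++ a b)) (≡.sym (ℕ.+-assoc (weightᵀ t) (weight a) (weight b)))

mutual
  ⇒T-weight : ∀ {s t} → s ⇒T t → weightᵀ s < weightᵀ t
  ⇒T-weight (root {g}) =
    s≤s (s≤s (≡.subst (weight g ℕ.≤_) (≡.sym (weight-++ g g)) (ℕ.m≤m+n (weight g) (weight g))))
  ⇒T-weight (inside {white} s) = s≤s (⇒D-weight s)
  ⇒T-weight (inside {black} s) = s≤s (s≤s (⇒D-weight s))

  ⇒D-weight : ∀ {f g} → f ⇒D g → weight f < weight g
  ⇒D-weight (here {f = f} s)  = ℕ.+-monoˡ-< (weight f) (⇒T-weight s)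
  ⇒D-weight (there {t = t} s) = ℕ.+-monoʳ-< (weightᵀ t) (⇒D-weight s)

≪-node : ∀ c r {a b} → a ≪ b → (node c a ∷ r) ≪ (node c b ∷ r)
≪-node c r = gmap (λ a → node c a ∷ r) (λ s → here (inside s))

⇒D-++ˡ : ∀ {a b} c → a ⇒D b → (a ++ c) ⇒D (b ++ c)
⇒D-++ˡ c (here s)  = here s
⇒D-++ˡ c (there s) = there (⇒D-++ˡ c s)

⇒D-++ʳ : ∀ a {b c} → b ⇒D c → (a ++ b) ⇒D (a ++ c)
⇒D-++ʳ []      s = s
⇒D-++ʳ (t ∷ a) s = there (⇒D-++ʳ a s)

≪-++ : ∀ {a b c d} → a ≪ b → c ≪ d → (a ++ c) ≪ (b ++ d)
≪-++ {b = b} {c} p q = gmap (_++ c) (⇒D-++ˡ c) p ◅◅ gmap (b ++_) (⇒D-++ʳ b) q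

≪-black-inv : ∀ {a g} → (node black a ∷ []) ≪ g → ∃ λ k → g ≡ node black k ∷ [] × a ≪ k
≪-black-inv ε                     = _ , refl , ε
≪-black-inv (here (inside s) ◅ r) with ≪-black-inv r
... | k , refl , q = k , refl , s ◅ q

≪-white-inv : ∀ {a g} → (node white a ∷ []) ≪ g →
  (∃ λ b → g ≡ node white b ∷ [] × a ≪ b) ⊎ (∃ λ k → g ≡ node black k ∷ [] × (a ++ a) ≪ k)
≪-white-inv ε                     = inj₁ (_ , refl , ε)
≪-white-inv (here root ◅ r)       = inj₂ (≪-black-inv r)
≪-white-inv (here (inside s) ◅ r) with ≪-white-inv r
... | inj₁ (b , refl , q) = inj₁ (b , refl , s ◅ q)
... | inj₂ (k , refl , q) = inj₂ (k , refl , ≪-++ (s ◅ ε) (s ◅ ε) ◅◅ q)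

splits-sound : ∀ g {a b} → (a , b) ∈ splits g → a ++ b ≡ g
splits-sound []      (here refl) = refl
splits-sound (t ∷ g) (here refl) = refl
splits-sound (t ∷ g) (there m) with ∈-map⁻ _ m
... | _ , m′ , refl = cong (t ∷_) (splits-sound g m′)

splits-complete : ∀ a b → (a , b) ∈ splits (a ++ b)
splits-complete []      []      = here refl
splits-complete []      (t ∷ b) = here refl
splits-complete (t ∷ a) b       = there (∈-map⁺ _ (splits-complete a b))

splits-unique : ∀ g → Unique (splits g)
splits-unique []      = All.[] ∷ []
splits-unique (t ∷ g) =
  All.map⁺ (All.universal (λ _ ()) (splits g)) ∷
  Unique.map⁺ (λ { {_ , _} {_ , _} refl → refl }) (splits-unique g)

halves : Forest → List Forest
halves g = map proj₁ (filter (λ p → proj₁ p ≟F proj₂ p) (splits g))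

∈-halves⁻ : ∀ {a g} → a ∈ halves g → a ++ a ≡ g
∈-halves⁻ {g = g} m with ∈-map∘filter⁻ proj₁ (λ p → proj₁ p ≟F proj₂ p) m
... | (a , .a) , m′ , refl , refl = splits-sound g m′

∈-halves⁺ : ∀ a → a ∈ halves (a ++ a)
∈-halves⁺ a =
  ∈-map∘filter⁺ proj₁ (λ p → proj₁ p ≟F proj₂ p) ((a , a) , splits-complete a a , refl , refl)

mutual
  predecessorsᵀ : Tree → List Tree
  predecessorsᵀ (node c g) = map (node c) (predecessors g) ++ rootPredecessors c g

  rootPredecessors : Colour → Forest → List Tree
  rootPredecessors white g = []
  rootPredecessors black g = map (node white) (halves g)

  predecessors : Forest → List Forest
  predecessors []      = []
  predecessors (t ∷ f) = map (_∷ f) (predecessorsᵀ t) ++ map (t ∷_) (predecessors f)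

mutual
  predecessorsᵀ-sound : ∀ t {s} → s ∈ predecessorsᵀ t → s ⇒T t
  predecessorsᵀ-sound (node c g) m with ∈-++⁻ (map (node c) (predecessors g)) m
  ... | inj₁ m′ with ∈-map⁻ _ m′
  ...   | _ , m″ , refl = inside (predecessors-sound g m″)
  predecessorsᵀ-sound (node black g) m | inj₂ m′ with ∈-map⁻ _ m′
  ...   | _ , m″ , refl with ∈-halves⁻ {g = g} m″
  ...     | refl = root

  predecessors-sound : ∀ g {f} → f ∈ predecessors g → f ⇒D g
  predecessors-sound (t ∷ g) m with ∈-++⁻ (map (_∷ g) (predecessorsᵀ t)) m
  ... | inj₁ m′ with ∈-map⁻ _ m′
  ...   | _ , m″ , refl = here (predecessorsᵀ-sound t m″)
  predecessors-sound (t ∷ g) m | inj₂ m′ with ∈-map⁻ _ m′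
  ...   | _ , m″ , refl = there (predecessors-sound g m″)

mutual
  predecessorsᵀ-complete : ∀ {s t} → s ⇒T t → s ∈ predecessorsᵀ t
  predecessorsᵀ-complete (root {g}) =
    ∈-++⁺ʳ (map (node black) (predecessors (g ++ g))) (∈-map⁺ _ (∈-halves⁺ g))
  predecessorsᵀ-complete (inside s) = ∈-++⁺ˡ (∈-map⁺ _ (predecessors-complete s))

  predecessors-complete : ∀ {f g} → f ⇒D g → f ∈ predecessors g
  predecessors-complete (here s) = ∈-++⁺ˡ (∈-map⁺ _ (predecessorsᵀ-complete s))
  predecessors-complete (there {t = t} {f' = f′} s) =
    ∈-++⁺ʳ (map (_∷ f′) (predecessorsᵀ t)) (∈-map⁺ _ (predecessors-complete s))

-- Fuel n suffices as soon as n exceeds the weight of g, since weight strictly decreases backwards.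
ancestors : ℕ → Forest → List Forest
ancestors zero    g = []
ancestors (suc n) g = g ∷ concatMap (ancestors n) (predecessors g)

ancestors-sound : ∀ n g {f} → f ∈ ancestors n g → f ≪ g
ancestors-sound (suc n) g (here refl) = ε
ancestors-sound (suc n) g (there m) with find (∈-concatMap⁻ (ancestors n) m)
... | h , h∈ , m′ = ancestors-sound n h m′ ◅◅ (predecessors-sound g h∈ ◅ ε)

ancestors-complete : ∀ n {g f} → Star (flip _⇒D_) g f → weight g < n → f ∈ ancestors n g
ancestors-complete zero    _       ()
ancestors-complete (suc n) ε       _       = here refl
ancestors-complete (suc n) (s ◅ r) (s≤s w) =
  there (∈-concatMap⁺ (ancestors n) (lose (predecessors-complete s)
    (ancestors-complete n r (ℕ.<-≤-trans (⇒D-weight s) w))))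

≪-finite : ∀ g → ∃ λ (L : List Forest) → Unique L × (∀ f → f ∈ L ⇔ f ≪ g)
≪-finite g = deduplicate _≟F_ A , deduplicate-! A , λ f →
  mk⇔ (λ m → ancestors-sound _ g (∈-deduplicate⁻ _≟F_ A m))
      (λ p → ∈-deduplicate⁺ _≟F_ (ancestors-complete _ (reverse id p) (ℕ.n<1+n (weight g))))
  where A = ancestors (suc (weight g)) g

data Ladder : Forest → Set where
  [] : Ladder []
  ∘∷ : ∀ {f} → Ladder f → Ladder (∘ f ∷ [])

ladder-depth-injective : ∀ {l l′} → Ladder l → Ladder l′ → depth l ≡ depth l′ → l ≡ l′
ladder-depth-injective []     []      _ = refl
ladder-depth-injective (∘∷ p) (∘∷ p′) e =
  cong (λ l → ∘ l ∷ []) (ladder-depth-injective p p′ (ℕ.suc-injective e))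

doubled-ladder-depth-injective : ∀ {l l′} → Ladder l → Ladder l′ →
  depth (l ++ l) ≡ depth (l′ ++ l′) → l ≡ l′
doubled-ladder-depth-injective {l} {l′} p p′ e =
  ladder-depth-injective p p′ (≡.trans (≡.sym (depth-double l)) (≡.trans e (depth-double l′)))

DoubledLadder : Forest → Set
DoubledLadder f = ∃ λ l → Ladder l × f ≡ l ++ l

Below : (Forest → Set) → Forest → Set
Below Q g = ∃ λ f → Q f × f ≪ g

¬Below-ladder-∷∷ : ∀ {t t′ r} → ¬ Below Ladder (t ∷ t′ ∷ r)
¬Below-ladder-∷∷ ([]     , [] , q) with () ← ≪-length q
¬Below-ladder-∷∷ (_ ∷ [] , ∘∷ _ , q) with () ← ≪-length q

below-∘ : ∀ h → Below Ladder (∘ h ∷ []) ⇔ Below Ladder h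
below-∘ h = mk⇔ to (λ { (l , p , q) → ∘ l ∷ [] , ∘∷ p , ≪-node white [] q })
  where
  to : Below Ladder (∘ h ∷ []) → Below Ladder h
  to ([] , [] , q) with () ← ≪-length q
  to (_ , ∘∷ p , q) with ≪-white-inv q
  ... | inj₁ (_ , refl , q′) = _ , p , q′
  ... | inj₂ (_ , ()   , _)

below-• : ∀ h → Below Ladder (• h ∷ []) ⇔ Below DoubledLadder h
below-• h = mk⇔ to λ { (_ , (l , p , refl) , q) → ∘ l ∷ [] , ∘∷ p , here root ◅ ≪-node black [] q }
  where
  to : Below Ladder (• h ∷ []) → Below DoubledLadder h
  to ([] , [] , q) with () ← ≪-length q
  to (_ , ∘∷ p , q) with ≪-white-inv q
  ... | inj₁ (_ , ()   , _)
  ... | inj₂ (_ , refl , q′) = _ , (_ , p , refl) , q′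

ladders-below-unique : ∀ {l l′ g} → Ladder l → Ladder l′ → l ≪ g → l′ ≪ g → l ≡ l′
ladders-below-unique p p′ q q′ =
  ladder-depth-injective p p′ (≡.trans (≪-depth q) (≡.sym (≪-depth q′)))

doubled-ladders-below-unique : ∀ {f f′ g} → DoubledLadder f → DoubledLadder f′ →
  f ≪ g → f′ ≪ g → f ≡ f′
doubled-ladders-below-unique (l , p , refl) (l′ , p′ , refl) q q′ =
  cong (λ l → l ++ l) (doubled-ladder-depth-injective p p′
    (≡.trans (≪-depth q) (≡.sym (≪-depth q′))))

module Coefficients {c ℓ : Level} (K : Field c ℓ) where
  open Series K
  open Field K
    using (Carrier; _≈_; 0#; 1#; _+_; +-identityˡ; +-identityʳ; +-cong; +-congʳ)
    renaming (refl to ≈-refl; sym to ≈-sym; trans to ≈-trans)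

  Indicator : Set → Carrier → Set ℓ
  Indicator P a = (P × a ≈ 1#) ⊎ (¬ P × a ≈ 0#)

  private variable
    P P′ : Set
    a b : Carrier

  indicator-yes : P → Indicator P a → a ≈ 1#
  indicator-yes _ (inj₁ (_ , a≈1)) = a≈1
  indicator-yes p (inj₂ (¬p , _))  = ⊥-elim (¬p p)

  indicator-no : ¬ P → Indicator P a → a ≈ 0#
  indicator-no ¬p (inj₁ (p , _))   = ⊥-elim (¬p p)
  indicator-no _  (inj₂ (_ , a≈0)) = a≈0

  indicator-⇔ : P ⇔ P′ → Indicator P a → Indicator P′ a
  indicator-⇔ P⇔P′ (inj₁ (p , a≈1))  = inj₁ (Equivalence.to P⇔P′ p , a≈1)
  indicator-⇔ P⇔P′ (inj₂ (¬p , a≈0)) = inj₂ ((λ p′ → ¬p (Equivalence.from P⇔P′ p′)) , a≈0)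

  indicator-≈ : a ≈ b → Indicator P a → Indicator P b
  indicator-≈ a≈b (inj₁ (p , a≈1))  = inj₁ (p , ≈-trans (≈-sym a≈b) a≈1)
  indicator-≈ a≈b (inj₂ (¬p , a≈0)) = inj₂ (¬p , ≈-trans (≈-sym a≈b) a≈0)

  indicator-unique : P ⇔ P′ → Indicator P a → Indicator P′ b → a ≈ b
  indicator-unique P⇔P′ (inj₁ (p , a≈1)) ind =
    ≈-trans a≈1 (≈-sym (indicator-yes (Equivalence.to P⇔P′ p) ind))
  indicator-unique P⇔P′ (inj₂ (¬p , a≈0)) ind =
    ≈-trans a≈0 (≈-sym (indicator-no (λ p′ → ¬p (Equivalence.from P⇔P′ p′)) ind))

  sum-indicator : ∀ {A : Set} (S : A → Carrier) (Q : A → Set) {L : List A} → Unique L →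
    (∀ {x y} → x ∈ L → y ∈ L → Q x → Q y → x ≡ y) →
    (∀ x → Indicator (Q x) (S x)) → Indicator (∃ λ x → x ∈ L × Q x) (sumL (map S L))
  sum-indicator S Q {[]}    _           _  _   = inj₂ ((λ { (_ , () , _) }) , ≈-refl)
  sum-indicator S Q {x ∷ L} (x∉L ∷ uL) uq ind
    with ind x | sum-indicator S Q uL (λ m m′ → uq (there m) (there m′)) ind
  ... | inj₁ (qx , _) | inj₁ ((y , y∈L , qy) , _) =
    ⊥-elim (All.lookup x∉L y∈L (uq (here refl) (there y∈L) qx qy))
  ... | inj₁ (qx , Sx≈1) | inj₂ (_ , s≈0) =
    inj₁ ((x , here refl , qx) , ≈-trans (+-cong Sx≈1 s≈0) (+-identityʳ 1#))
  ... | inj₂ (_ , Sx≈0)  | inj₁ ((y , y∈L , qy) , s≈1) =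
    inj₁ ((y , there y∈L , qy) , ≈-trans (+-cong Sx≈0 s≈1) (+-identityˡ 1#))
  ... | inj₂ (¬qx , Sx≈0) | inj₂ (¬∃ , s≈0) =
    inj₂ ((λ { (_ , here refl , q) → ¬qx q ; (y , there m , q) → ¬∃ (y , m , q) }) ,
          ≈-trans (+-cong Sx≈0 s≈0) (+-identityʳ 0#))

  gr-indicator : ∀ {S T} (Q : Forest → Set) → (∀ f → Indicator (Q f) (S f)) →
    (∀ {f f′ g} → Q f → Q f′ → f ≪ g → f′ ≪ g → f ≡ f′) →
    IsGr S T → ∀ g → Indicator (Below Q g) (T g)
  gr-indicator {S} Q ind uq isGr g with isGr g
  ... | L , uL , L⇔ , Tg≈ =
    indicator-≈ (≈-sym Tg≈) (indicator-⇔ ∃∈L⇔Below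
      (sum-indicator S Q uL (λ m m′ q q′ → uq q q′ (to m) (to m′)) ind))
    where
    to : ∀ {f} → f ∈ L → f ≪ g
    to = Equivalence.to (L⇔ _)
    ∃∈L⇔Below : (∃ λ f → f ∈ L × Q f) ⇔ Below Q g
    ∃∈L⇔Below = mk⇔ (λ { (f , m , q) → f , q , to m })
                     (λ { (f , q , p) → f , Equivalence.from (L⇔ f) p , q })

  ld-indicator : ∀ f → Indicator (Ladder f) (ld f)
  ld-indicator []                    = inj₁ ([] , ≈-refl)
  ld-indicator (node white h ∷ [])   with ld-indicator h
  ... | inj₁ (p , e)  = inj₁ (∘∷ p , e)
  ... | inj₂ (¬p , e) = inj₂ ((λ { (∘∷ p) → ¬p p }) , e)
  ld-indicator (node white h ∷ _ ∷ _) = inj₂ ((λ ()) , ≈-refl)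
  ld-indicator (node black h ∷ _)     = inj₂ ((λ ()) , ≈-refl)

  Δld-indicator : ∀ a b → Indicator (a ≡ b × Ladder a) (Δ ld a b)
  Δld-indicator a b with a ≟F b
  ... | yes refl = indicator-⇔ (mk⇔ (refl ,_) proj₂) (ld-indicator a)
  ... | no a≢b   = inj₂ ((λ p → a≢b (proj₁ p)) , ≈-refl)

  P²⊙Δld-indicator : ∀ g → Indicator (DoubledLadder g) (P²⊙ (Δ ld) g)
  P²⊙Δld-indicator g =
    indicator-⇔ diagonal⇔DoubledLadder
      (sum-indicator (λ p → Δ ld (proj₁ p) (proj₂ p)) Diagonal (splits-unique g) diagonal-unique
        (λ p → Δld-indicator (proj₁ p) (proj₂ p)))
    where
    Diagonal : Forest × Forest → Set
    Diagonal (a , b) = a ≡ b × Ladder a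
    diagonal-unique : ∀ {p p′} → p ∈ splits g → p′ ∈ splits g → Diagonal p → Diagonal p′ → p ≡ p′
    diagonal-unique {l , _} {l′ , _} m m′ (refl , q) (refl , q′) =
      cong (λ l → l , l) (doubled-ladder-depth-injective q q′
        (cong depth (≡.trans (splits-sound g m) (≡.sym (splits-sound g m′)))))
    diagonal⇔DoubledLadder : (∃ λ p → p ∈ splits g × Diagonal p) ⇔ DoubledLadder g
    diagonal⇔DoubledLadder =
      mk⇔ (λ { ((l , _) , m , refl , q) → l , q , ≡.sym (splits-sound g m) })
          (λ { (l , q , refl) → (l , l) , splits-complete l l , refl , q })

  gr-exists : ∀ S → Σ Ser (IsGr S)
  gr-exists S = (λ g → sumL (map S (proj₁ (≪-finite g)))) ,
                λ g → let L , uL , L⇔ = ≪-finite g in L , uL , L⇔ , ≈-refl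

  gr-ld-equation : ∀ {G H} → IsGr ld G → IsGr (P²⊙ (Δ ld)) H → G ≋ ((εS ⊕ ∘̄ G) ⊕ •̄ H)
  gr-ld-equation {G} {H} isG isH = equation
    where
    G-indicator : ∀ g → Indicator (Below Ladder g) (G g)
    G-indicator = gr-indicator Ladder ld-indicator ladders-below-unique isG

    H-indicator : ∀ h → Indicator (Below DoubledLadder h) (H h)
    H-indicator = gr-indicator DoubledLadder P²⊙Δld-indicator doubled-ladders-below-unique isH

    equation : ∀ g → G g ≈ ((εS ⊕ ∘̄ G) ⊕ •̄ H) g
    equation [] =
      ≈-trans (indicator-yes ([] , [] , ε) (G-indicator []))
              (≈-sym (≈-trans (+-identityʳ _) (+-identityʳ 1#)))
    equation (node white h ∷ []) =
      ≈-trans (indicator-unique (below-∘ h) (G-indicator _) (G-indicator h))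
              (≈-sym (≈-trans (+-identityʳ _) (+-identityˡ _)))
    equation (node black h ∷ []) =
      ≈-trans (indicator-unique (below-• h) (G-indicator _) (H-indicator h))
              (≈-sym (≈-trans (+-congʳ (+-identityˡ 0#)) (+-identityˡ _)))
    equation (node white h ∷ t ∷ r) =
      ≈-trans (indicator-no ¬Below-ladder-∷∷ (G-indicator _))
              (≈-sym (≈-trans (+-identityʳ _) (+-identityʳ 0#)))
    equation (node black h ∷ t ∷ r) =
      ≈-trans (indicator-no ¬Below-ladder-∷∷ (G-indicator _))
              (≈-sym (≈-trans (+-identityʳ _) (+-identityʳ 0#)))

-- All coefficients involved are 0 or 1, so the characteristic of K plays no role.
theorem3p2 : ∀ {c ℓ : Level} (K : Field c ℓ) → CharacteristicZero K →
    let open Series K in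
      Σ Ser (IsGr ld) × Σ Ser (IsGr (P²⊙ (Δ ld))) ×
      (∀ (G H : Ser) → IsGr ld G → IsGr (P²⊙ (Δ ld)) H →
        G ≋ ((εS ⊕ ∘̄ G) ⊕ •̄ H))
theorem3p2 K _ = gr-exists _ , gr-exists _ , λ _ _ → gr-ld-equation
  where open Coefficients K
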